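{- Let $\Gamma = \langle \sigma_1, \sigma_2 \rangle$ be a group generated by two elements, and suppose that for some integer $k$ the subgroup $N = \langle \sigma_2^k \rangle$ is normal in $\Gamma$ and $\Gamma/N$ (with generators the images of $\sigma_1,\sigma_2$) is tight. Then $\Gamma$ is tight.
   Context: A group $\langle\sigma_1,\sigma_2\rangle$ with two distinguished generators is called tight if $\langle\sigma_1,\sigma_2\rangle=\langle\sigma_1\rangle\langle\sigma_2\rangle$, i.e. every element can be written as $\sigma_1^a\sigma_2^b$ for some integers $a,b$. -}

module Defs where

open import Level using (_⊔_)
open import Data.Nat using (ℕ; zero; suc)
open import Data.Integer using (ℤ; +_; -[1+_]; _*_)
open import Data.Product using (Σ; ∃; _×_)
open import Algebra.Bundles using (Group)

module _ {c ℓ} (G : Group c ℓ) where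
  open Group G

  powℕ : Carrier → ℕ → Carrier
  powℕ x zero    = ε
  powℕ x (suc n) = x ∙ powℕ x n

  pow : Carrier → ℤ → Carrier
  pow x (+ n)      = powℕ x n
  pow x -[1+ n ]   = (powℕ x (suc n)) ⁻¹

  data InGen (s₁ s₂ : Carrier) : Carrier → Set (c ⊔ ℓ) where
    gen₁ : InGen s₁ s₂ s₁
    gen₂ : InGen s₁ s₂ s₂
    gen-ε : InGen s₁ s₂ ε
    gen-∙ : ∀ {x y} → InGen s₁ s₂ x → InGen s₁ s₂ y → InGen s₁ s₂ (x ∙ y)
    gen-⁻¹ : ∀ {x} → InGen s₁ s₂ x → InGen s₁ s₂ (x ⁻¹)
    gen-≈ : ∀ {x y} → x ≈ y → InGen s₁ s₂ x → InGen s₁ s₂ y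

  GeneratedBy : Carrier → Carrier → Set (c ⊔ ℓ)
  GeneratedBy s₁ s₂ = ∀ g → InGen s₁ s₂ g

  InCyclic : Carrier → Carrier → Set ℓ
  InCyclic h x = ∃ λ (m : ℤ) → x ≈ pow h m

  IsNormal : (Carrier → Set ℓ) → Set (c ⊔ ℓ)
  IsNormal N = ∀ g n → N n → N (g ∙ n ∙ g ⁻¹)

  Tight : Carrier → Carrier → Set (c ⊔ ℓ)
  Tight s₁ s₂ = ∀ g → ∃ λ (a : ℤ) → ∃ λ (b : ℤ) → g ≈ pow s₁ a ∙ pow s₂ b

  -- G/N with generators the images of s₁, s₂ is tight, for N a normal
  -- subgroup: every coset gN equals (s₁^a s₂^b)N, i.e. g ∈ s₁^a s₂^b N.
  TightModulo : (Carrier → Set ℓ) → Carrier → Carrier → Set (c ⊔ ℓ)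
  TightModulo N s₁ s₂ = ∀ g → ∃ λ (a : ℤ) → ∃ λ (b : ℤ) → ∃ λ n →
    N n × (g ≈ (pow s₁ a ∙ pow s₂ b) ∙ n)

module Submission where

-- Write g = σ₁^a σ₂^b n with n ∈ N = ⟨σ₂^k⟩. Since ⟨σ₂⟩ is a subgroup containing σ₂^k, it
-- contains N, so σ₂^b n = σ₂^d for some d and g = σ₁^a σ₂^d.

open import Defs
open import Data.Integer using (ℤ; +_; -[1+_])
open import Data.Nat using (zero; suc)
open import Data.Product using (_,_)
open import Algebra.Bundles using (Group)
import Algebra.Properties.Group as GroupProperties
import Relation.Binary.Reasoning.Setoid as SetoidReasoning

module CyclicSubgroup {c ℓ} (G : Group c ℓ) (x : Group.Carrier G) where
  open Group G
  open GroupProperties G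
  open SetoidReasoning setoid

  powℕ-comm : ∀ n → powℕ G x n ∙ x ≈ x ∙ powℕ G x n
  powℕ-comm zero    = trans (identityˡ x) (sym (identityʳ x))
  powℕ-comm (suc n) = begin
    (x ∙ powℕ G x n) ∙ x ≈⟨ assoc _ _ _ ⟩
    x ∙ (powℕ G x n ∙ x) ≈⟨ ∙-congˡ (powℕ-comm n) ⟩
    x ∙ (x ∙ powℕ G x n) ∎

  inCyclic-resp : ∀ {y z} → y ≈ z → InCyclic G x y → InCyclic G x z
  inCyclic-resp y≈z (d , y≈xᵈ) = d , trans (sym y≈z) y≈xᵈ

  inCyclic-ε : InCyclic G x ε
  inCyclic-ε = + 0 , refl

  x∙pow-inCyclic : ∀ d → InCyclic G x (x ∙ pow G x d)
  x∙pow-inCyclic (+ n)            = + suc n , refl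
  x∙pow-inCyclic -[1+ zero ]      = + 0 , (begin
    x ∙ (x ∙ ε) ⁻¹ ≈⟨ ∙-congˡ (⁻¹-cong (identityʳ x)) ⟩
    x ∙ x ⁻¹       ≈⟨ inverseʳ x ⟩
    ε              ∎)
  x∙pow-inCyclic -[1+ suc n ]     = -[1+ n ] , (begin
    x ∙ (x ∙ (x ∙ p)) ⁻¹    ≈⟨ ∙-congˡ (⁻¹-cong (∙-congˡ (sym (powℕ-comm n)))) ⟩
    x ∙ (x ∙ (p ∙ x)) ⁻¹    ≈⟨ ∙-congˡ (⁻¹-cong (sym (assoc _ _ _))) ⟩
    x ∙ ((x ∙ p) ∙ x) ⁻¹    ≈⟨ ∙-congˡ (⁻¹-anti-homo-∙ _ _) ⟩
    x ∙ (x ⁻¹ ∙ (x ∙ p) ⁻¹) ≈⟨ sym (assoc _ _ _) ⟩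
    (x ∙ x ⁻¹) ∙ (x ∙ p) ⁻¹ ≈⟨ ∙-congʳ (inverseʳ x) ⟩
    ε ∙ (x ∙ p) ⁻¹          ≈⟨ identityˡ _ ⟩
    (x ∙ p) ⁻¹              ∎)
    where p = powℕ G x n

  x⁻¹∙pow-inCyclic : ∀ d → InCyclic G x (x ⁻¹ ∙ pow G x d)
  x⁻¹∙pow-inCyclic (+ zero)   = -[1+ 0 ] , (begin
    x ⁻¹ ∙ ε   ≈⟨ identityʳ _ ⟩
    x ⁻¹       ≈⟨ ⁻¹-cong (sym (identityʳ x)) ⟩
    (x ∙ ε) ⁻¹ ∎)
  x⁻¹∙pow-inCyclic (+ suc n)  = + n , (begin
    x ⁻¹ ∙ (x ∙ p) ≈⟨ sym (assoc _ _ _) ⟩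
    (x ⁻¹ ∙ x) ∙ p ≈⟨ ∙-congʳ (inverseˡ x) ⟩
    ε ∙ p          ≈⟨ identityˡ _ ⟩
    p              ∎)
    where p = powℕ G x n
  x⁻¹∙pow-inCyclic -[1+ n ]   = -[1+ suc n ] , (begin
    x ⁻¹ ∙ (x ∙ p) ⁻¹ ≈⟨ sym (⁻¹-anti-homo-∙ _ _) ⟩
    ((x ∙ p) ∙ x) ⁻¹  ≈⟨ ⁻¹-cong (assoc _ _ _) ⟩
    (x ∙ (p ∙ x)) ⁻¹  ≈⟨ ⁻¹-cong (∙-congˡ (powℕ-comm n)) ⟩
    (x ∙ (x ∙ p)) ⁻¹  ∎)
    where p = powℕ G x n

  inCyclic-x∙ : ∀ {y} → InCyclic G x y → InCyclic G x (x ∙ y)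
  inCyclic-x∙ (d , y≈xᵈ) = inCyclic-resp (∙-congˡ (sym y≈xᵈ)) (x∙pow-inCyclic d)

  inCyclic-x⁻¹∙ : ∀ {y} → InCyclic G x y → InCyclic G x (x ⁻¹ ∙ y)
  inCyclic-x⁻¹∙ (d , y≈xᵈ) = inCyclic-resp (∙-congˡ (sym y≈xᵈ)) (x⁻¹∙pow-inCyclic d)

  inCyclic-powℕ∙ : ∀ n {y} → InCyclic G x y → InCyclic G x (powℕ G x n ∙ y)
  inCyclic-powℕ∙ zero    y∈ = inCyclic-resp (sym (identityˡ _)) y∈
  inCyclic-powℕ∙ (suc n) y∈ = inCyclic-resp (sym (assoc _ _ _)) (inCyclic-x∙ (inCyclic-powℕ∙ n y∈))

  inCyclic-powℕ⁻¹∙ : ∀ n {y} → InCyclic G x y → InCyclic G x (powℕ G x n ⁻¹ ∙ y)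
  inCyclic-powℕ⁻¹∙ zero        y∈ =
    inCyclic-resp (trans (sym (identityˡ _)) (∙-congʳ (sym ε⁻¹≈ε))) y∈
  inCyclic-powℕ⁻¹∙ (suc n) {y} y∈ =
    inCyclic-resp reassociate (inCyclic-powℕ⁻¹∙ n (inCyclic-x⁻¹∙ y∈))
    where
    reassociate : powℕ G x n ⁻¹ ∙ (x ⁻¹ ∙ y) ≈ (x ∙ powℕ G x n) ⁻¹ ∙ y
    reassociate = trans (sym (assoc _ _ _)) (∙-congʳ (sym (⁻¹-anti-homo-∙ _ _)))

  inCyclic-∙ : ∀ {y z} → InCyclic G x y → InCyclic G x z → InCyclic G x (y ∙ z)
  inCyclic-∙ (+ n      , y≈xⁿ) z∈ = inCyclic-resp (∙-congʳ (sym y≈xⁿ)) (inCyclic-powℕ∙ n z∈)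
  inCyclic-∙ (-[1+ n ] , y≈xⁿ) z∈ = inCyclic-resp (∙-congʳ (sym y≈xⁿ)) (inCyclic-powℕ⁻¹∙ (suc n) z∈)

  inCyclic-⁻¹ : ∀ {y} → InCyclic G x y → InCyclic G x (y ⁻¹)
  inCyclic-⁻¹ (+ zero    , y≈ε)   = + 0 , trans (⁻¹-cong y≈ε) ε⁻¹≈ε
  inCyclic-⁻¹ (+ suc n   , y≈xⁿ)  = -[1+ n ] , ⁻¹-cong y≈xⁿ
  inCyclic-⁻¹ (-[1+ n ]  , y≈x⁻ⁿ) = + suc n , trans (⁻¹-cong y≈x⁻ⁿ) (⁻¹-involutive _)

  inCyclic-powℕ : ∀ {y} → InCyclic G x y → ∀ n → InCyclic G x (powℕ G y n)
  inCyclic-powℕ y∈ zero    = inCyclic-ε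
  inCyclic-powℕ y∈ (suc n) = inCyclic-∙ y∈ (inCyclic-powℕ y∈ n)

  inCyclic-pow : ∀ {y} → InCyclic G x y → ∀ m → InCyclic G x (pow G y m)
  inCyclic-pow y∈ (+ n)    = inCyclic-powℕ y∈ n
  inCyclic-pow y∈ -[1+ n ] = inCyclic-⁻¹ (inCyclic-powℕ y∈ (suc n))

  inCyclic-powᵏ⇒inCyclic : ∀ k {y} → InCyclic G (pow G x k) y → InCyclic G x y
  inCyclic-powᵏ⇒inCyclic k (m , y≈xᵏᵐ) =
    inCyclic-resp (sym y≈xᵏᵐ) (inCyclic-pow (k , refl) m)

module _ {c ℓ} (G : Group c ℓ) where
  open Group G

  tightModulo⇒tight : ∀ {N : Carrier → Set ℓ} {s₁ s₂} →
    (∀ {n} → N n → InCyclic G s₂ n) → TightModulo G N s₁ s₂ → Tight G s₁ s₂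
  tightModulo⇒tight {s₁ = s₁} {s₂} N⊆⟨s₂⟩ tightModN g
    with a , b , n , n∈N , g≈s₁ᵃs₂ᵇn ← tightModN g
    with d , s₂ᵇn≈s₂ᵈ ← CyclicSubgroup.inCyclic-∙ G s₂ (b , refl) (N⊆⟨s₂⟩ n∈N)
    = a , d , (begin
      g                             ≈⟨ g≈s₁ᵃs₂ᵇn ⟩
      (pow G s₁ a ∙ pow G s₂ b) ∙ n ≈⟨ assoc _ _ _ ⟩
      pow G s₁ a ∙ (pow G s₂ b ∙ n) ≈⟨ ∙-congˡ s₂ᵇn≈s₂ᵈ ⟩
      pow G s₁ a ∙ pow G s₂ d       ∎)
    where open SetoidReasoning setoid

proposition2p3 : ∀ {c ℓ} (Γ : Group c ℓ) (σ₁ σ₂ : Group.Carrier Γ) (k : ℤ) →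
    GeneratedBy Γ σ₁ σ₂ →
    IsNormal Γ (InCyclic Γ (pow Γ σ₂ k)) →
    TightModulo Γ (InCyclic Γ (pow Γ σ₂ k)) σ₁ σ₂ →
    Tight Γ σ₁ σ₂
proposition2p3 Γ σ₁ σ₂ k _ _ =
  tightModulo⇒tight Γ (CyclicSubgroup.inCyclic-powᵏ⇒inCyclic Γ σ₂ k)
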